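{- Let $(\mathcal A,\gamma,\phi)$ be a $\mathbb Z_2$-graded noncommutative probability space and let $\mathcal U$ be the infinite graded tensor product of copies of $\mathcal A$, with $\mathcal A_k$ the $k$-th copy and $X^{(k)}$ the image of $X\in\mathcal A$ in $\mathcal A_k$. Then the algebras $(\mathcal A_k)_{k\in\mathbb N}$ are interchangeable, i.e. for all $X_1,\dots,X_n\in\mathcal A$, indices $i_1,\dots,i_n\in\mathbb N$ and permutations $\sigma$ of $\mathbb N$, $\tilde\phi(X_1^{(i_1)}\cdots X_n^{(i_n)})=\tilde\phi(X_1^{(\sigma(i_1))}\cdots X_n^{(\sigma(i_n))})$.
   Context: A $\mathbb Z_2$-graded noncommutative probability space $(\mathcal A,\gamma,\phi)$ consists of a unital complex algebra $\mathcal A=\mathcal A_+\oplus\mathcal A_-$, a unital linear functional $\phi$ and an automorphism $\gamma$ of order 2 with $\phi\circ\gamma=\phi$, where $\mathcal A_\pm=\{X:\gamma(X)=\pm X\}$; elements of $\mathcal A_\pm$ are homogeneous with degree $\partial X=0$ on $\mathcal A_+$ and $\partial X=1$ on $\mathcal A_-$. The graded tensor product of graded algebras is the vector space tensor product with multiplication $(X_1\otimes X_2)(X_1'\otimes X_2')=(-1)^{\partial X_2\,\partial X_1'}X_1X_1'\otimes X_2X_2'$ for homogeneous elements (extended bilinearly), and functional $\phi_1\otimes\phi_2$; it is associative. The infinite graded tensor product $\mathcal U$ is spanned by elementary tensors $a_1\otimes a_2\otimes\cdots$ with all but finitely many $a_k=1$, multiplied by iterating this sign rule, i.e. for homogeneous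 entries $(a_1\otimes a_2\otimes\cdots)(b_1\otimes b_2\otimes\cdots)=(-1)^{\sum_{i>j}\partial a_i\partial b_j}a_1b_1\otimes a_2b_2\otimes\cdots$, with $\tilde\phi(a_1\otimes a_2\otimes\cdots)=\prod_k\phi(a_k)$; $X^{(k)}$ is the elementary tensor with $X$ in position $k$ and $1$ elsewhere. -}

module Defs where

open import Level using (Level; _⊔_; suc)
open import Algebra.Bundles using (CommutativeRing; Ring)
open import Data.Bool using (Bool; true; false; _xor_; _∧_)
open import Data.List using (List; []; _∷_; map; concatMap; foldr; replicate)
open import Data.Nat using (ℕ; zero) renaming (suc to sucℕ)
open import Data.Product using (_×_; _,_; proj₁; proj₂)
open import Data.Fin using (Fin)
open import Data.Vec.Functional using (Vector; foldr) renaming (map to vmap)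

-- Z₂-graded noncommutative probability space over a scalar ring K.
-- (The paper uses K = ℂ; stdlib has no ℂ, so K is an arbitrary
--  commutative ring in which 2 is invertible, witnessed by `half`.)

record Scalars (c ℓ : Level) : Set (Level.suc (c ⊔ ℓ)) where
  field
    K    : CommutativeRing c ℓ
  open CommutativeRing K public
  field
    half     : Carrier
    half+half : half + half ≈ 1#

record GradedNCProbSpace {c ℓ} (S : Scalars c ℓ) (a ℓa : Level)
       : Set (Level.suc (c ⊔ ℓ ⊔ a ⊔ ℓa)) where
  private module K = Scalars S
  field
    𝒜 : Ring a ℓa
  open Ring 𝒜 public
  field
    _·_        : K.Carrier → Carrier → Carrier
    ·-cong     : ∀ {k l x y} → k K.≈ l → x ≈ y → (k · x) ≈ (l · y)
    ·-distribˡ : ∀ k x y → (k · (x + y)) ≈ ((k · x) + (k · y))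
    ·-distribʳ : ∀ k l x → ((k K.+ l) · x) ≈ ((k · x) + (l · x))
    ·-assoc    : ∀ k l x → ((k K.* l) · x) ≈ (k · (l · x))
    ·-identity : ∀ x → (K.1# · x) ≈ x
    ·-*ˡ       : ∀ k x y → ((k · x) * y) ≈ (k · (x * y))
    ·-*ʳ       : ∀ k x y → (x * (k · y)) ≈ (k · (x * y))
    γ          : Carrier → Carrier
    γ-cong     : ∀ {x y} → x ≈ y → γ x ≈ γ y
    γ-+        : ∀ x y → γ (x + y) ≈ (γ x + γ y)
    γ-*        : ∀ x y → γ (x * y) ≈ (γ x * γ y)
    γ-1        : γ 1# ≈ 1#
    γ-·        : ∀ k x → γ (k · x) ≈ (k · γ x)
    γ-invol    : ∀ x → γ (γ x) ≈ x
    φ          : Carrier → K.Carrier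
    φ-cong     : ∀ {x y} → x ≈ y → φ x K.≈ φ y
    φ-+        : ∀ x y → φ (x + y) K.≈ (φ x K.+ φ y)
    φ-·        : ∀ k x → φ (k · x) K.≈ (k K.* φ x)
    φ-1        : φ 1# K.≈ K.1#
    φ-γ        : ∀ x → φ (γ x) K.≈ φ x

-- An elementary tensor with homogeneous entries a₀ ⊗ a₁ ⊗ ⋯ is
-- represented by a list of (entry, degree) pairs; positions beyond the
-- list carry (1, even).  Degrees are Bools (true = odd).  An element of
-- 𝒰 is represented by a formal K-linear combination of such tensors
-- (a list of (coefficient, tensor) pairs); 𝒰 itself is the quotient of
-- these by multilinearity, and φ̃ is well defined on that quotient, so
-- evaluating φ̃ on representatives is faithful.

module TensorProduct {c ℓ a ℓa} {S : Scalars c ℓ}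
                     (P : GradedNCProbSpace S a ℓa) where
  private module K = Scalars S
  open GradedNCProbSpace P

  HTensor : Set a
  HTensor = List (Carrier × Bool)

  𝒰 : Set (c ⊔ a)
  𝒰 = List (K.Carrier × HTensor)

  oddCount : HTensor → Bool
  oddCount []             = false
  oddCount ((_ , d) ∷ as) = d xor oddCount as

  -- parity of Σ_{i>j} ∂aᵢ ∂bⱼ (positions from 0)
  signExp : HTensor → HTensor → Bool
  signExp []             _              = false
  signExp (_ ∷ as)       []             = false
  signExp (_ ∷ as)       ((_ , e) ∷ bs) = (e ∧ oddCount as) xor signExp as bs

  zipMul : HTensor → HTensor → HTensor
  zipMul []             bs             = bs
  zipMul as@(_ ∷ _)     []             = as
  zipMul ((x , d) ∷ as) ((y , e) ∷ bs) = (x * y , d xor e) ∷ zipMul as bs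

  sgn : Bool → K.Carrier
  sgn false = K.1#
  sgn true  = K.- K.1#

  tmul : K.Carrier × HTensor → K.Carrier × HTensor → K.Carrier × HTensor
  tmul (k , as) (l , bs) = (sgn (signExp as bs) K.* (k K.* l)) , zipMul as bs

  _⊛_ : 𝒰 → 𝒰 → 𝒰
  u ⊛ v = concatMap (λ s → map (tmul s) v) u

  𝟙 : 𝒰
  𝟙 = (K.1# , []) ∷ []

  even-part odd-part : Carrier → Carrier
  even-part X = K.half · (X + γ X)
  odd-part  X = K.half · (X - γ X)

  atPos : ℕ → Carrier × Bool → HTensor
  atPos zero     xd = xd ∷ []
  atPos (sucℕ k) xd = (1# , false) ∷ atPos k xd

  _^⟨_⟩ : Carrier → ℕ → 𝒰
  X ^⟨ k ⟩ = (K.1# , atPos k (even-part X , false))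
           ∷ (K.1# , atPos k (odd-part X , true)) ∷ []

  φ̃-tensor : HTensor → K.Carrier
  φ̃-tensor []             = K.1#
  φ̃-tensor ((x , _) ∷ as) = φ x K.* φ̃-tensor as

  φ̃ : 𝒰 → K.Carrier
  φ̃ []             = K.0#
  φ̃ ((k , t) ∷ u) = (k K.* φ̃-tensor t) K.+ φ̃ u

  prodAt : (n : ℕ) → (Fin n → Carrier) → (Fin n → ℕ) → 𝒰
  prodAt n X i = Data.Vec.Functional.foldr _⊛_ 𝟙 (λ j → X j ^⟨ i j ⟩)

module Submission where

-- Splitting every X^{(k)} into its even and odd part expands X₁^{(i₁)} ⋯ Xₙ^{(iₙ)} into a
-- sum over words of homogeneous letters.  The term of a word is ± the elementary tensor
-- whose k-th entry is the ordered product of the letters at position k, the sign being the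
-- parity of the pairs of odd letters whose positions appear in decreasing order.  An
-- injective relabelling f of the positions keeps the entries and multiplies the sign by
-- the parity of the pairs of odd letters whose order f reverses.  Since φ = φ ∘ γ, φ kills
-- odd elements, so a term contributes only when every position carries an even number of
-- odd letters; but then that parity is even, being a sum over pairs of positions weighted
-- by their degrees.  Hence each term keeps its value.

open import Defs
open import Data.Nat using (ℕ)
open import Data.Fin using (Fin)
open import Function.Bundles using (_↔_; Inverse)

open import Algebra.Bundles using (CommutativeMonoid; Ring)
import Algebra.Properties.CommutativeSemigroup as CommutativeSemigroupProperties
import Algebra.Properties.Ring as RingProperties
open import Data.Bool using (Bool; true; false; _xor_; _∧_; not)
open import Data.Bool.Properties
  using (xor-∧-commutativeRing; xor-annihilates-not; xor-assoc; xor-identityʳ; ∧-zeroʳ; ∧-identityʳ)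
open import Data.Empty using (⊥-elim)
import Data.Fin as Fin
open import Data.List using (List; []; _∷_; map; length)
import Data.List.Relation.Binary.Pointwise as Pointwise
open Pointwise using (Pointwise; []; _∷_; ++⁺; map⁺)
open import Data.List.Relation.Unary.All using (All; []; _∷_)
open import Data.Maybe using (just; nothing)
open import Data.Nat using (zero; suc; _≤_; _<ᵇ_; z≤n; s≤s)
open import Data.Nat.Properties using (_≟_; suc-injective; ≤-trans; ≤-refl; m≤n⇒m≤1+n)
open import Data.Product using (_×_; _,_; proj₁; proj₂; Σ; map₁)
open import Function.Base using (_∘_)
open import Function.Bundles using (Injection)
open import Function.Definitions using (Injective)
open import Function.Properties.Inverse using (Inverse⇒Injection)
open import Level using (_⊔_)
import Relation.Binary.PropositionalEquality as ≡
open ≡ using (_≡_; _≢_; refl; cong; cong₂)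
import Relation.Binary.Reasoning.Setoid as SetoidReasoning
open import Relation.Nullary using (yes; no)
open import Tactic.RingSolver using (solve-∀)
open import Tactic.RingSolver.Core.AlmostCommutativeRing using (AlmostCommutativeRing; fromCommutativeRing)

xor-∧-ring : AlmostCommutativeRing _ _
xor-∧-ring = fromCommutativeRing xor-∧-commutativeRing λ { false → just refl ; true → nothing }

n<ᵇn : ∀ n → (n <ᵇ n) ≡ false
n<ᵇn zero    = refl
n<ᵇn (suc n) = n<ᵇn n

<ᵇ-flip : ∀ m n → m ≢ n → (m <ᵇ n) ≡ not (n <ᵇ m)
<ᵇ-flip zero    zero    m≢n = ⊥-elim (m≢n refl)
<ᵇ-flip zero    (suc n) _   = refl
<ᵇ-flip (suc m) zero    _   = refl
<ᵇ-flip (suc m) (suc n) m≢n = <ᵇ-flip m n (m≢n ∘ cong suc)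

module _ {r₁ r₂ s₁ s₂} (R : Ring r₁ r₂) (T : Ring s₁ s₂) where
  private
    module R = Ring R
    module T = Ring T
    open RingProperties T

  additive⇒-‿homo : (h : R.Carrier → T.Carrier) →
                     (∀ {x y} → x R.≈ y → h x T.≈ h y) →
                     (∀ x y → h (x R.+ y) T.≈ h x T.+ h y) →
                     ∀ x → h (R.- x) T.≈ T.- h x
  additive⇒-‿homo h h-cong h-+ x = +-inverseˡ-unique (h (R.- x)) (h x) (begin
    h (R.- x) T.+ h x  ≈⟨ h-+ (R.- x) x ⟨
    h (R.- x R.+ x)    ≈⟨ h-cong (R.-‿inverseˡ x) ⟩
    h R.0#             ≈⟨ h-0 ⟩
    T.0#               ∎)
    where
      open SetoidReasoning T.setoid
      h-0 : h R.0# T.≈ T.0#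
      h-0 = +-identityˡ-unique (h R.0#) (h R.0#)
              (T.trans (T.sym (h-+ R.0# R.0#)) (h-cong (R.+-identityˡ R.0#)))

module FiniteProduct {c ℓ} (M : CommutativeMonoid c ℓ) where
  private
    module M = CommutativeMonoid M
  open M using (Carrier; _≈_; _∙_; ε)
  open CommutativeSemigroupProperties M.commutativeSemigroup using (x∙yz≈y∙xz)

  ∏< : ℕ → (ℕ → Carrier) → Carrier
  ∏< zero    g = ε
  ∏< (suc L) g = g 0 ∙ ∏< L (g ∘ suc)

  ∏<-cong : ∀ L {g h} → (∀ q → g q ≈ h q) → ∏< L g ≈ ∏< L h
  ∏<-cong zero    g≈h = M.refl
  ∏<-cong (suc L) g≈h = M.∙-cong (g≈h 0) (∏<-cong L (g≈h ∘ suc))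

  ∏<-ε : ∀ L {g} → (∀ q → g q ≈ ε) → ∏< L g ≈ ε
  ∏<-ε zero    g≈ε = M.refl
  ∏<-ε (suc L) g≈ε = M.trans (M.∙-cong (g≈ε 0) (∏<-ε L (g≈ε ∘ suc))) (M.identityˡ ε)

  -- h is g with its p-th factor replaced by ε; that factor is ε anyway when p is out of range.
  ∏<-extract : ∀ L p {g h} → (∀ q → q ≢ p → g q ≈ h q) → h p ≈ ε → (L ≤ p → g p ≈ ε) →
               ∏< L g ≈ g p ∙ ∏< L h
  ∏<-extract zero    p       g≈h hp≈ε gp≈ε = M.sym (M.trans (M.identityʳ _) (gp≈ε z≤n))
  ∏<-extract (suc L) zero    g≈h hp≈ε gp≈ε =
    M.∙-congˡ (M.trans (∏<-cong L (λ q → g≈h (suc q) λ ()))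
                       (M.sym (M.trans (M.∙-congʳ hp≈ε) (M.identityˡ _))))
  ∏<-extract (suc L) (suc p) {g} {h} g≈h hp≈ε gp≈ε =
    M.trans (M.∙-cong (g≈h 0 λ ())
                      (∏<-extract L p (λ q q≢p → g≈h (suc q) (q≢p ∘ suc-injective)) hp≈ε (gp≈ε ∘ s≤s)))
            (x∙yz≈y∙xz (h 0) (g (suc p)) _)

module _ {c ℓ a ℓa} {S : Scalars c ℓ} (P : GradedNCProbSpace S a ℓa) where
  private
    module K = Scalars S
    module A = GradedNCProbSpace P
    module AP = RingProperties A.𝒜
    module KP = RingProperties K.ring
  open A using (γ; φ; _·_)
  open TensorProduct P
  open FiniteProduct K.*-commutativeMonoid

  signed : Bool → A.Carrier → A.Carrier
  signed false x = x
  signed true  x = A.- x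

  signed-* : ∀ s t x y → signed s x A.* signed t y A.≈ signed (s xor t) (x A.* y)
  signed-* false false x y = A.refl
  signed-* false true  x y = A.sym (AP.-‿distribʳ-* x y)
  signed-* true  false x y = A.sym (AP.-‿distribˡ-* x y)
  signed-* true  true  x y = A.trans (A.sym (AP.-‿distribˡ-* x (A.- y)))
                               (A.trans (A.-‿cong (A.sym (AP.-‿distribʳ-* x y))) (AP.-‿involutive (x A.* y)))

  IsHomogeneous : A.Carrier × Bool → Set ℓa
  IsHomogeneous (x , d) = γ x A.≈ signed d x

  even-part-even : ∀ X → IsHomogeneous (even-part X , false)
  even-part-even X = A.trans (A.γ-· K.half (X A.+ γ X)) (A.·-cong K.refl (begin
    γ (X A.+ γ X)      ≈⟨ A.γ-+ X (γ X) ⟩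
    γ X A.+ γ (γ X)    ≈⟨ A.+-congˡ (A.γ-invol X) ⟩
    γ X A.+ X          ≈⟨ A.+-comm (γ X) X ⟩
    X A.+ γ X          ∎))
    where open SetoidReasoning A.setoid

  odd-part-odd : ∀ X → IsHomogeneous (odd-part X , true)
  odd-part-odd X = A.trans (A.γ-· K.half (X A.- γ X)) (begin
    K.half · γ (X A.- γ X)            ≈⟨ A.·-cong K.refl (A.γ-+ X (A.- γ X)) ⟩
    K.half · (γ X A.+ γ (A.- γ X))    ≈⟨ A.·-cong K.refl (A.+-congˡ (γ-‿homo (γ X))) ⟩
    K.half · (γ X A.- γ (γ X))        ≈⟨ A.·-cong K.refl (A.+-congˡ (A.-‿cong (A.γ-invol X))) ⟩
    K.half · (γ X A.- X)              ≈⟨ A.·-cong K.refl (AP.⁻¹-anti-homo‿- X (γ X)) ⟨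
    K.half · (A.- (X A.- γ X))        ≈⟨ half·-‿homo (X A.- γ X) ⟩
    A.- (K.half · (X A.- γ X))        ∎)
    where
      open SetoidReasoning A.setoid
      γ-‿homo = additive⇒-‿homo A.𝒜 A.𝒜 γ A.γ-cong A.γ-+
      half·-‿homo = additive⇒-‿homo A.𝒜 A.𝒜 (K.half ·_) (A.·-cong K.refl) (A.·-distribˡ K.half)

  -- φ = φ ∘ γ forces φ x = - φ x, and 2 is invertible in K.
  φ-odd≈0 : ∀ {x} → IsHomogeneous (x , true) → φ x K.≈ K.0#
  φ-odd≈0 {x} γx≈-x = begin
    φ x                                       ≈⟨ K.*-identityˡ (φ x) ⟨
    K.1# K.* φ x                              ≈⟨ K.*-congʳ K.half+half ⟨
    (K.half K.+ K.half) K.* φ x               ≈⟨ K.distribʳ (φ x) K.half K.half ⟩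
    K.half K.* φ x K.+ K.half K.* φ x         ≈⟨ K.+-congˡ (K.*-congˡ φx≈-φx) ⟩
    K.half K.* φ x K.+ K.half K.* K.- φ x     ≈⟨ K.distribˡ K.half (φ x) (K.- φ x) ⟨
    K.half K.* (φ x K.- φ x)                  ≈⟨ K.*-congˡ (K.-‿inverseʳ (φ x)) ⟩
    K.half K.* K.0#                           ≈⟨ K.zeroʳ K.half ⟩
    K.0#                                      ∎
    where
      open SetoidReasoning K.setoid
      φx≈-φx : φ x K.≈ K.- φ x
      φx≈-φx = K.trans (K.sym (A.φ-γ x))
                 (K.trans (A.φ-cong γx≈-x) (additive⇒-‿homo A.𝒜 K.ring φ A.φ-cong A.φ-+ x))

  sgn-xor : ∀ s t → sgn (s xor t) K.≈ sgn s K.* sgn t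
  sgn-xor false t     = K.sym (K.*-identityˡ (sgn t))
  sgn-xor true  false = K.sym (K.*-identityʳ (K.- K.1#))
  sgn-xor true  true  = K.sym (K.trans (KP.-1*x≈-x (K.- K.1#)) (KP.-‿involutive K.1#))

  -- A letter x at position p with degree d stands for the homogeneous element x^{(p)}.
  Letter : Set a
  Letter = ℕ × A.Carrier × Bool

  Word : Set a
  Word = List Letter

  IsHomogeneousWord : Word → Set (a ⊔ ℓa)
  IsHomogeneousWord = All (IsHomogeneous ∘ proj₂)

  term : Word → K.Carrier × HTensor
  term []             = K.1# , []
  term ((p , xd) ∷ w) = tmul (K.1# , atPos p xd) (term w)

  tensor : Word → HTensor
  tensor w = proj₂ (term w)

  factorAt : ℕ → Word → A.Carrier
  factorAt q []                = A.1#
  factorAt q ((p , x , _) ∷ w) with p ≟ q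
  ... | yes _ = x A.* factorAt q w
  ... | no  _ = factorAt q w

  degreeAt : ℕ → Word → Bool
  degreeAt q []                = false
  degreeAt q ((p , _ , d) ∷ w) with p ≟ q
  ... | yes _ = d xor degreeAt q w
  ... | no  _ = degreeAt q w

  deleteAt : ℕ → Word → Word
  deleteAt p []            = []
  deleteAt p ((q , xd) ∷ w) with q ≟ p
  ... | yes _ = deleteAt p w
  ... | no  _ = (q , xd) ∷ deleteAt p w

  φ̃-factors : ℕ → Word → K.Carrier
  φ̃-factors L w = ∏< L (λ q → φ (factorAt q w))

  SupportedBelow : ℕ → Word → Set ℓa
  SupportedBelow L w = ∀ q → L ≤ q → factorAt q w A.≈ A.1#

  factorAt-homogeneous : ∀ q {w} → IsHomogeneousWord w → IsHomogeneous (factorAt q w , degreeAt q w)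
  factorAt-homogeneous q []                          = A.γ-1
  factorAt-homogeneous q {(p , x , d) ∷ w} (hx ∷ hw) with p ≟ q
  ... | yes _ = A.trans (A.γ-* _ _) (A.trans (A.*-cong hx (factorAt-homogeneous q hw))
                                             (signed-* d (degreeAt q w) _ _))
  ... | no  _ = factorAt-homogeneous q hw

  deleteAt-homogeneous : ∀ p {w} → IsHomogeneousWord w → IsHomogeneousWord (deleteAt p w)
  deleteAt-homogeneous p []                    = []
  deleteAt-homogeneous p {(q , _) ∷ w} (hx ∷ hw) with q ≟ p
  ... | yes _ = deleteAt-homogeneous p hw
  ... | no  _ = hx ∷ deleteAt-homogeneous p hw

  length-deleteAt : ∀ p w → length (deleteAt p w) ≤ length w
  length-deleteAt p []             = z≤n
  length-deleteAt p ((q , _) ∷ w) with q ≟ p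
  ... | yes _ = m≤n⇒m≤1+n (length-deleteAt p w)
  ... | no  _ = s≤s (length-deleteAt p w)

  length-deleteAt-head : ∀ p xd w → length (deleteAt p ((p , xd) ∷ w)) ≤ length w
  length-deleteAt-head p xd w with p ≟ p
  ... | yes _   = length-deleteAt p w
  ... | no  p≢p = ⊥-elim (p≢p refl)

  factorAt-deleteAt-same : ∀ p w → factorAt p (deleteAt p w) A.≈ A.1#
  factorAt-deleteAt-same p []             = A.refl
  factorAt-deleteAt-same p ((q , _) ∷ w) with q ≟ p
  ... | yes _ = factorAt-deleteAt-same p w
  ... | no  q≢p with q ≟ p
  ...   | yes q≡p = ⊥-elim (q≢p q≡p)
  ...   | no  _   = factorAt-deleteAt-same p w

  factorAt-deleteAt-other : ∀ {q p} w → q ≢ p → factorAt q (deleteAt p w) A.≈ factorAt q w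
  factorAt-deleteAt-other []                _   = A.refl
  factorAt-deleteAt-other {q} {p} ((r , x , _) ∷ w) q≢p with r ≟ p
  ... | no  _    with r ≟ q
  ...   | yes _ = A.*-congˡ (factorAt-deleteAt-other w q≢p)
  ...   | no  _ = factorAt-deleteAt-other w q≢p
  factorAt-deleteAt-other {q} {p} ((r , x , _) ∷ w) q≢p | yes refl with r ≟ q
  ...   | yes refl = ⊥-elim (q≢p refl)
  ...   | no  _    = factorAt-deleteAt-other w q≢p

  SupportedBelow-deleteAt : ∀ {L} p w → SupportedBelow L w → SupportedBelow L (deleteAt p w)
  SupportedBelow-deleteAt p w supp q L≤q with q ≟ p
  ... | yes refl = factorAt-deleteAt-same p w
  ... | no  q≢p  = A.trans (factorAt-deleteAt-other w q≢p) (supp q L≤q)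

  φ̃-factors-deleteAt : ∀ {L} p w → SupportedBelow L w →
                      φ̃-factors L w K.≈ φ (factorAt p w) K.* φ̃-factors L (deleteAt p w)
  φ̃-factors-deleteAt {L} p w supp = ∏<-extract L p
    (λ q q≢p → A.φ-cong (A.sym (factorAt-deleteAt-other w q≢p)))
    (K.trans (A.φ-cong (factorAt-deleteAt-same p w)) A.φ-1)
    (λ L≤p → K.trans (A.φ-cong (supp p L≤p)) A.φ-1)

  entry : HTensor → ℕ → A.Carrier
  entry []            q       = A.1#
  entry ((x , _) ∷ t) zero    = x
  entry (_ ∷ t)       (suc q) = entry t q

  entry-zipMul : ∀ s t q → entry (zipMul s t) q A.≈ entry s q A.* entry t q
  entry-zipMul []            t             q       = A.sym (A.*-identityˡ _)
  entry-zipMul (_ ∷ _)       []            q       = A.sym (A.*-identityʳ _)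
  entry-zipMul (_ ∷ s)       (_ ∷ t)       zero    = A.refl
  entry-zipMul (_ ∷ s)       (_ ∷ t)       (suc q) = entry-zipMul s t q

  entry-atPos-same : ∀ p x d → entry (atPos p (x , d)) p ≡ x
  entry-atPos-same zero    x d = refl
  entry-atPos-same (suc p) x d = entry-atPos-same p x d

  entry-atPos-other : ∀ {p q} x d → p ≢ q → entry (atPos p (x , d)) q ≡ A.1#
  entry-atPos-other {zero}  {zero}  x d p≢q = ⊥-elim (p≢q refl)
  entry-atPos-other {zero}  {suc q} x d p≢q = refl
  entry-atPos-other {suc p} {zero}  x d p≢q = refl
  entry-atPos-other {suc p} {suc q} x d p≢q = entry-atPos-other x d (p≢q ∘ cong suc)

  entry-beyond : ∀ t {q} → length t ≤ q → entry t q ≡ A.1#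
  entry-beyond []      _         = refl
  entry-beyond (_ ∷ t) (s≤s t≤q) = entry-beyond t t≤q

  entry-tensor : ∀ w q → entry (tensor w) q A.≈ factorAt q w
  entry-tensor []                q = A.refl
  entry-tensor ((p , x , d) ∷ w) q with p ≟ q
  ... | yes refl = A.trans (entry-zipMul (atPos p (x , d)) (tensor w) p)
                     (A.*-cong (A.reflexive (entry-atPos-same p x d)) (entry-tensor w p))
  ... | no  p≢q  = A.trans (entry-zipMul (atPos p (x , d)) (tensor w) q)
                     (A.trans (A.*-cong (A.reflexive (entry-atPos-other x d p≢q)) (entry-tensor w q))
                              (A.*-identityˡ _))

  SupportedBelow-tensor : ∀ w → SupportedBelow (length (tensor w)) w
  SupportedBelow-tensor w q L≤q = A.trans (A.sym (entry-tensor w q)) (A.reflexive (entry-beyond (tensor w) L≤q))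

  φ̃-tensor-∏ : ∀ t → φ̃-tensor t ≡ ∏< (length t) (λ q → φ (entry t q))
  φ̃-tensor-∏ []            = refl
  φ̃-tensor-∏ ((x , _) ∷ t) = cong (φ x K.*_) (φ̃-tensor-∏ t)

  oddPrefix : ℕ → HTensor → Bool
  oddPrefix zero    _             = false
  oddPrefix (suc p) []            = false
  oddPrefix (suc p) ((_ , d) ∷ t) = d xor oddPrefix p t

  oddPrefix-[] : ∀ p → oddPrefix p [] ≡ false
  oddPrefix-[] zero    = refl
  oddPrefix-[] (suc p) = refl

  oddCount-atPos : ∀ p x d → oddCount (atPos p (x , d)) ≡ d
  oddCount-atPos zero    x d = xor-identityʳ d
  oddCount-atPos (suc p) x d = oddCount-atPos p x d

  signExp-atPos : ∀ p x d t → signExp (atPos p (x , d)) t ≡ d ∧ oddPrefix p t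
  signExp-atPos zero    x d []            = ≡.sym (∧-zeroʳ d)
  signExp-atPos zero    x d ((_ , e) ∷ t) =
    ≡.trans (xor-identityʳ (e ∧ false)) (≡.trans (∧-zeroʳ e) (≡.sym (∧-zeroʳ d)))
  signExp-atPos (suc p) x d []            = ≡.sym (∧-zeroʳ d)
  signExp-atPos (suc p) x d ((_ , e) ∷ t)
    rewrite oddCount-atPos p x d | signExp-atPos p x d t = ∧-distribˡ-xor′ e d (oddPrefix p t)
    where
      ∧-distribˡ-xor′ : ∀ e d o → (e ∧ d) xor (d ∧ o) ≡ d ∧ (e xor o)
      ∧-distribˡ-xor′ = solve-∀ xor-∧-ring

  oddPrefix-zipMul : ∀ p s t → oddPrefix p (zipMul s t) ≡ oddPrefix p s xor oddPrefix p t
  oddPrefix-zipMul p       []            t             rewrite oddPrefix-[] p = refl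
  oddPrefix-zipMul p       (e ∷ s)       []            rewrite oddPrefix-[] p = ≡.sym (xor-identityʳ _)
  oddPrefix-zipMul zero    (_ ∷ s)       (_ ∷ t)       = refl
  oddPrefix-zipMul (suc p) ((_ , d) ∷ s) ((_ , e) ∷ t) rewrite oddPrefix-zipMul p s t =
    interchange d e (oddPrefix p s) (oddPrefix p t)
    where
      interchange : ∀ d e a b → (d xor e) xor (a xor b) ≡ (d xor a) xor (e xor b)
      interchange = solve-∀ xor-∧-ring

  oddPrefix-atPos : ∀ p r x d → oddPrefix p (atPos r (x , d)) ≡ d ∧ (r <ᵇ p)
  oddPrefix-atPos zero    r       x d = ≡.sym (∧-zeroʳ d)
  oddPrefix-atPos (suc p) zero    x d rewrite oddPrefix-[] p = ≡.trans (xor-identityʳ d) (≡.sym (∧-identityʳ d))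
  oddPrefix-atPos (suc p) (suc r) x d = oddPrefix-atPos p r x d

  oddBelow : ℕ → Word → Bool
  oddBelow p []                = false
  oddBelow p ((r , _ , d) ∷ w) = (d ∧ (r <ᵇ p)) xor oddBelow p w

  inversions : Word → Bool
  inversions []                = false
  inversions ((p , _ , d) ∷ w) = (d ∧ oddBelow p w) xor inversions w

  oddPrefix-tensor : ∀ p w → oddPrefix p (tensor w) ≡ oddBelow p w
  oddPrefix-tensor p []                = oddPrefix-[] p
  oddPrefix-tensor p ((r , x , d) ∷ w)
    rewrite oddPrefix-zipMul p (atPos r (x , d)) (tensor w) | oddPrefix-atPos p r x d | oddPrefix-tensor p w = refl

  term-sign : ∀ w → proj₁ (term w) K.≈ sgn (inversions w)
  term-sign []                = K.refl
  term-sign ((p , x , d) ∷ w) rewrite signExp-atPos p x d (tensor w) | oddPrefix-tensor p w =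
    K.trans (K.*-congˡ (K.trans (K.*-identityˡ _) (term-sign w)))
            (K.sym (sgn-xor (d ∧ oddBelow p w) (inversions w)))

  φ̃-term : K.Carrier × HTensor → K.Carrier
  φ̃-term (k , t) = k K.* φ̃-tensor t

  φ̃-term-term : ∀ w → φ̃-term (term w) K.≈ sgn (inversions w) K.* φ̃-factors (length (tensor w)) w
  φ̃-term-term w = K.*-cong (term-sign w) (begin
    φ̃-tensor (tensor w)                                       ≡⟨ φ̃-tensor-∏ (tensor w) ⟩
    ∏< (length (tensor w)) (λ q → φ (entry (tensor w) q))     ≈⟨ ∏<-cong (length (tensor w)) (λ q → A.φ-cong (entry-tensor w q)) ⟩
    φ̃-factors (length (tensor w)) w                          ∎)
    where open SetoidReasoning K.setoid

  module Relabel (f : ℕ → ℕ) (f-injective : Injective _≡_ _≡_ f) where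

    relabel : Word → Word
    relabel = map (map₁ f)

    factorAt-relabel : ∀ q w → factorAt (f q) (relabel w) ≡ factorAt q w
    factorAt-relabel q []                = refl
    factorAt-relabel q ((p , x , d) ∷ w) with f p ≟ f q | p ≟ q
    ... | yes _     | yes _    = cong (x A.*_) (factorAt-relabel q w)
    ... | no  _     | no  _    = factorAt-relabel q w
    ... | yes fp≡fq | no  p≢q  = ⊥-elim (p≢q (f-injective fp≡fq))
    ... | no  fp≢fq | yes refl = ⊥-elim (fp≢fq refl)

    deleteAt-relabel : ∀ p w → relabel (deleteAt p w) ≡ deleteAt (f p) (relabel w)
    deleteAt-relabel p []             = refl
    deleteAt-relabel p ((q , xd) ∷ w) with f q ≟ f p | q ≟ p
    ... | yes _     | yes _    = deleteAt-relabel p w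
    ... | no  _     | no  _    = cong ((f q , xd) ∷_) (deleteAt-relabel p w)
    ... | yes fq≡fp | no  q≢p  = ⊥-elim (q≢p (f-injective fq≡fp))
    ... | no  fq≢fp | yes refl = ⊥-elim (fq≢fp refl)

    reversed : ℕ → ℕ → Bool
    reversed p q = (q <ᵇ p) xor (f q <ᵇ f p)

    reversedWith : ℕ → Word → Bool
    reversedWith p []                = false
    reversedWith p ((q , _ , d) ∷ w) = (d ∧ reversed p q) xor reversedWith p w

    crossings : Word → Bool
    crossings []                = false
    crossings ((p , _ , d) ∷ w) = (d ∧ reversedWith p w) xor crossings w

    reversed-irrefl : ∀ p → reversed p p ≡ false
    reversed-irrefl p rewrite n<ᵇn p | n<ᵇn (f p) = refl

    reversed-sym : ∀ {p q} → p ≢ q → reversed p q ≡ reversed q p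
    reversed-sym {p} {q} p≢q rewrite <ᵇ-flip p q p≢q | <ᵇ-flip (f p) (f q) (p≢q ∘ f-injective) =
      ≡.sym (xor-annihilates-not (q <ᵇ p) (f q <ᵇ f p))

    reversedWith-oddBelow : ∀ p w → reversedWith p w ≡ oddBelow p w xor oddBelow (f p) (relabel w)
    reversedWith-oddBelow p []                = refl
    reversedWith-oddBelow p ((r , _ , d) ∷ w) rewrite reversedWith-oddBelow p w =
      ∧-distribˡ-xor-interchange d (r <ᵇ p) (f r <ᵇ f p) (oddBelow p w) (oddBelow (f p) (relabel w))
      where
        ∧-distribˡ-xor-interchange : ∀ d a b x y → (d ∧ (a xor b)) xor (x xor y) ≡ ((d ∧ a) xor x) xor ((d ∧ b) xor y)
        ∧-distribˡ-xor-interchange = solve-∀ xor-∧-ring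

    inversions-relabel : ∀ w → inversions (relabel w) ≡ inversions w xor crossings w
    inversions-relabel []                = refl
    inversions-relabel ((p , _ , d) ∷ w) rewrite reversedWith-oddBelow p w | inversions-relabel w =
      regroup d (oddBelow p w) (oddBelow (f p) (relabel w)) (inversions w) (crossings w)
      where
        regroup : ∀ d b b′ i c → (d ∧ b′) xor (i xor c) ≡ ((d ∧ b) xor i) xor ((d ∧ (b xor b′)) xor c)
        regroup = solve-∀ xor-∧-ring

    reversedWith-deleteAt : ∀ r p w → reversedWith r w ≡ reversedWith r (deleteAt p w) xor (degreeAt p w ∧ reversed r p)
    reversedWith-deleteAt r p []                = refl
    reversedWith-deleteAt r p ((s , _ , d) ∷ w) with s ≟ p
    ... | yes refl rewrite reversedWith-deleteAt r s w =
      regroup d (reversed r s) (reversedWith r (deleteAt s w)) (degreeAt s w)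
      where
        regroup : ∀ d c x e → (d ∧ c) xor (x xor (e ∧ c)) ≡ x xor ((d xor e) ∧ c)
        regroup = solve-∀ xor-∧-ring
    ... | no  _    rewrite reversedWith-deleteAt r p w =
      ≡.sym (xor-assoc (d ∧ reversed r s) (reversedWith r (deleteAt p w)) (degreeAt p w ∧ reversed r p))

    crossings-deleteAt : ∀ p w → crossings w ≡ crossings (deleteAt p w) xor (degreeAt p w ∧ reversedWith p w)
    crossings-deleteAt p []                = refl
    crossings-deleteAt p ((s , _ , d) ∷ w) with s ≟ p
    ... | yes refl rewrite crossings-deleteAt s w | reversed-irrefl s =
      regroup d (reversedWith s w) (crossings (deleteAt s w)) (degreeAt s w)
      where
        regroup : ∀ d x c e → (d ∧ x) xor (c xor (e ∧ x)) ≡ c xor ((d xor e) ∧ ((d ∧ false) xor x))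
        regroup = solve-∀ xor-∧-ring
    ... | no  s≢p  rewrite crossings-deleteAt p w | reversedWith-deleteAt s p w | reversed-sym s≢p =
      regroup d (reversedWith s (deleteAt p w)) (degreeAt p w) (reversed p s) (crossings (deleteAt p w)) (reversedWith p w)
      where
        regroup : ∀ d x e c y z → (d ∧ (x xor (e ∧ c))) xor (y xor (e ∧ z)) ≡ ((d ∧ x) xor y) xor (e ∧ ((d ∧ c) xor z))
        regroup = solve-∀ xor-∧-ring

    φ̃-factors-relabel : ∀ n w → length w ≤ n → ∀ {L L′} → SupportedBelow L w → SupportedBelow L′ (relabel w) →
                        φ̃-factors L w K.≈ φ̃-factors L′ (relabel w)
    φ̃-factors-relabel _ [] _ {L} {L′} _ _ = K.trans (∏<-ε L (λ _ → A.φ-1)) (K.sym (∏<-ε L′ (λ _ → A.φ-1)))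
    φ̃-factors-relabel (suc n) w@((p , xd) ∷ w′) (s≤s |w′|≤n) {L} {L′} supp supp′ = begin
      φ̃-factors L w                                                               ≈⟨ φ̃-factors-deleteAt p w supp ⟩
      φ (factorAt p w) K.* φ̃-factors L (deleteAt p w)                             ≈⟨ K.*-congˡ ih ⟩
      φ (factorAt p w) K.* φ̃-factors L′ (relabel (deleteAt p w))                  ≡⟨ cong₂ (λ x v → φ x K.* φ̃-factors L′ v)
                                                                                         (≡.sym (factorAt-relabel p w))
                                                                                         (deleteAt-relabel p w) ⟩
      φ (factorAt (f p) (relabel w)) K.* φ̃-factors L′ (deleteAt (f p) (relabel w)) ≈⟨ φ̃-factors-deleteAt (f p) (relabel w) supp′ ⟨
      φ̃-factors L′ (relabel w)                                                    ∎
      where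
        open SetoidReasoning K.setoid
        supp″ : SupportedBelow L′ (relabel (deleteAt p w))
        supp″ rewrite deleteAt-relabel p w = SupportedBelow-deleteAt (f p) (relabel w) supp′
        ih : φ̃-factors L (deleteAt p w) K.≈ φ̃-factors L′ (relabel (deleteAt p w))
        ih = φ̃-factors-relabel n (deleteAt p w) (≤-trans (length-deleteAt-head p xd w′) |w′|≤n)
               (SupportedBelow-deleteAt p w supp) supp″

    -- The first position either carries an odd product, which φ kills, or can be deleted
    -- without changing the parity of crossings.
    crossings⇒φ̃-factors≈0 : ∀ n w → length w ≤ n → ∀ {L} → IsHomogeneousWord w → SupportedBelow L w →
                            crossings w ≡ true → φ̃-factors L w K.≈ K.0#
    crossings⇒φ̃-factors≈0 (suc n) w@((p , xd) ∷ w′) (s≤s |w′|≤n) {L} hw supp cw =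
      K.trans (φ̃-factors-deleteAt p w supp) factor-or-rest≈0
      where
        factor-or-rest≈0 : φ (factorAt p w) K.* φ̃-factors L (deleteAt p w) K.≈ K.0#
        factor-or-rest≈0 with degreeAt p w in odd
        ... | true  = K.trans (K.*-congʳ (φ-odd≈0 (≡.subst (λ b → IsHomogeneous (factorAt p w , b)) odd
                                                             (factorAt-homogeneous p hw))))
                              (K.zeroˡ _)
        ... | false = K.trans (K.*-congˡ (crossings⇒φ̃-factors≈0 n (deleteAt p w)
                                          (≤-trans (length-deleteAt-head p xd w′) |w′|≤n)
                                          (deleteAt-homogeneous p hw) (SupportedBelow-deleteAt p w supp) c′))
                              (K.zeroʳ _)
          where
            c′ : crossings (deleteAt p w) ≡ true
            c′ = begin
              crossings (deleteAt p w)                                             ≡⟨ xor-identityʳ _ ⟨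
              crossings (deleteAt p w) xor (false ∧ reversedWith p w)             ≡⟨ cong (λ b → crossings (deleteAt p w) xor (b ∧ reversedWith p w)) odd ⟨
              crossings (deleteAt p w) xor (degreeAt p w ∧ reversedWith p w)      ≡⟨ crossings-deleteAt p w ⟨
              crossings w                                                          ≡⟨ cw ⟩
              true                                                                 ∎
              where open ≡.≡-Reasoning

    φ̃-term-relabel : ∀ {w} → IsHomogeneousWord w → φ̃-term (term w) K.≈ φ̃-term (term (relabel w))
    φ̃-term-relabel {w} hw = begin
      φ̃-term (term w)                                                         ≈⟨ φ̃-term-term w ⟩
      sgn (inversions w) K.* φ̃-factors (length (tensor w)) w                   ≈⟨ sign-invariant ⟩
      sgn (inversions (relabel w)) K.* φ̃-factors L′ (relabel w)                ≈⟨ φ̃-term-term (relabel w) ⟨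
      φ̃-term (term (relabel w))                                               ∎
      where
        open SetoidReasoning K.setoid
        L  = length (tensor w)
        L′ = length (tensor (relabel w))
        F≈F′ : φ̃-factors L w K.≈ φ̃-factors L′ (relabel w)
        F≈F′ = φ̃-factors-relabel (length w) w ≤-refl (SupportedBelow-tensor w) (SupportedBelow-tensor (relabel w))
        sign-invariant : sgn (inversions w) K.* φ̃-factors L w K.≈ sgn (inversions (relabel w)) K.* φ̃-factors L′ (relabel w)
        sign-invariant rewrite inversions-relabel w with crossings w in c
        ... | false = K.*-cong (K.reflexive (cong sgn (≡.sym (xor-identityʳ (inversions w))))) F≈F′
        ... | true  = K.trans (K.*-congˡ F≈0) (K.trans (K.zeroʳ _)
                        (K.sym (K.trans (K.*-congˡ (K.trans (K.sym F≈F′) F≈0)) (K.zeroʳ _))))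
          where
            F≈0 : φ̃-factors L w K.≈ K.0#
            F≈0 = crossings⇒φ̃-factors≈0 (length w) w ≤-refl hw (SupportedBelow-tensor w) c

    Corresponding : (s s′ : K.Carrier × HTensor) → Set (c ⊔ a ⊔ ℓa)
    Corresponding s s′ = Σ Word λ w → IsHomogeneousWord w × s ≡ term w × s′ ≡ term (relabel w)

    φ̃-corresponding : ∀ {u v} → Pointwise Corresponding u v → φ̃ u K.≈ φ̃ v
    φ̃-corresponding []                                = K.refl
    φ̃-corresponding ((w , hw , refl , refl) ∷ u∼v) = K.+-cong (φ̃-term-relabel hw) (φ̃-corresponding u∼v)

    corresponding-prepend : ∀ {u v} p {xd} → IsHomogeneous xd → Pointwise Corresponding u v →
                            Pointwise Corresponding (map (tmul (K.1# , atPos p xd)) u)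
                                                    (map (tmul (K.1# , atPos (f p) xd)) v)
    corresponding-prepend p {xd} hx u∼v = map⁺ _ _ (Pointwise.map prepend u∼v)
      where
        prepend : ∀ {s s′} → Corresponding s s′ → Corresponding (tmul (K.1# , atPos p xd) s) (tmul (K.1# , atPos (f p) xd) s′)
        prepend (w , hw , refl , refl) = (p , xd) ∷ w , hx ∷ hw , refl , refl

    corresponding-⊛ : ∀ {u v} X k → Pointwise Corresponding u v →
                      Pointwise Corresponding ((X ^⟨ k ⟩) ⊛ u) ((X ^⟨ f k ⟩) ⊛ v)
    corresponding-⊛ X k u∼v = ++⁺ (corresponding-prepend k (even-part-even X) u∼v)
                                  (++⁺ (corresponding-prepend k (odd-part-odd X) u∼v) [])

    corresponding-prodAt : ∀ n X i → Pointwise Corresponding (prodAt n X i) (prodAt n X (f ∘ i))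
    corresponding-prodAt zero    X i = ([] , [] , refl , refl) ∷ []
    corresponding-prodAt (suc n) X i =
      corresponding-⊛ (X Fin.zero) (i Fin.zero) (corresponding-prodAt n (X ∘ Fin.suc) (i ∘ Fin.suc))

    φ̃-prodAt-relabel : ∀ n X i → φ̃ (prodAt n X i) K.≈ φ̃ (prodAt n X (f ∘ i))
    φ̃-prodAt-relabel n X i = φ̃-corresponding (corresponding-prodAt n X i)

proposition4p21 : ∀ {c ℓ a ℓa} (S : Scalars c ℓ) (P : GradedNCProbSpace S a ℓa)
    (n : ℕ) (X : Fin n → GradedNCProbSpace.Carrier P) (i : Fin n → ℕ) (σ : ℕ ↔ ℕ) →
    Scalars._≈_ S (TensorProduct.φ̃ P (TensorProduct.prodAt P n X i))
                  (TensorProduct.φ̃ P (TensorProduct.prodAt P n X (λ j → Inverse.to σ (i j))))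
proposition4p21 S P n X i σ =
  Relabel.φ̃-prodAt-relabel P (Inverse.to σ) (Injection.injective (Inverse⇒Injection σ)) n X i
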